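{- Let $P$ be a poset, $W$ a $T_1$ topological space and $\{X_p\mid p\in P\}$ a semi-trim $P$-partition of $W$. Then the isolated points of $W$ are precisely the points which, for some maximal element $p$ of $P$, are isolated points of $X_p$ (in its subspace topology).
   Context: Let $(P,\le)$ be a poset and $W$ a topological space. A $P$-partition of $W$ is a family $\{X_p\mid p\in P\}$ of pairwise disjoint non-empty subsets of $W$ (their union need not be $W$). For $Y\subseteq W$, $T(Y)=\{p: Y\cap X_p\neq\emptyset\}$. An open set $A$ is $p$-trim ($t(A)=p$) if $T(A)=\{q:q\ge p\}$, trim if $p$-trim for some $p$. $\widehat P=\{p: W$ contains a $p$-trim set$\}$. The partition is semi-trim if: every point of $W$ has a neighbourhood base of trim sets; if $A$ is open and $p\in T(A)\cap\widehat P$ then $A$ contains a $p$-trim subset; if $x\in X_p$ then $p=\sup_P\{t(A): A\text{ trim}, x\in A\}$; and for each $p$ every point of $W$ with a neighbourhood base of $p$-trim sets lies in $X_p$. -}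

module Defs where

open import Level using (0ℓ) renaming (suc to lsuc)
open import Data.Product using (Σ; ∃; _×_; _,_)
open import Data.Empty using (⊥)
open import Data.Unit using (⊤)
open import Relation.Nullary using (¬_)
open import Relation.Unary using (Pred; _⊆_; _∈_)
open import Relation.Binary using (Rel)
open import Relation.Binary.PropositionalEquality using (_≡_; _≢_)

record Topology (W : Set) : Set₁ where
  field
    Open         : Pred W 0ℓ → Set
    -- openness depends only on the underlying subset
    Open-resp    : ∀ {U V : Pred W 0ℓ} → U ⊆ V → V ⊆ U → Open U → Open V
    Open-whole   : Open (λ _ → ⊤)
    -- arbitrary unions (the empty union gives the empty set)
    Open-⋃       : (I : Set) (U : I → Pred W 0ℓ) → (∀ i → Open (U i)) →
                   Open (λ x → Σ I λ i → U i x)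
    Open-∩       : ∀ {U V : Pred W 0ℓ} → Open U → Open V → Open (λ x → U x × V x)

open Topology public

IsT₁ : {W : Set} → Topology W → Set₁
IsT₁ {W} τ = ∀ (x y : W) → x ≢ y → Σ (Pred W 0ℓ) λ U → Open τ U × U x × ¬ U y

module _ {W P : Set} (τ : Topology W) (_≤_ : Rel P 0ℓ) (X : P → Pred W 0ℓ) where

  IsPPartition : Set
  IsPPartition = (∀ p q (x : W) → p ≢ q → X p x → X q x → ⊥) × (∀ p → ∃ λ x → X p x)

  T : Pred W 0ℓ → Pred P 0ℓ
  T Y p = ∃ λ x → Y x × X p x

  IsTrimAt : P → Pred W 0ℓ → Set
  IsTrimAt p A = Open τ A × (∀ q → (T A q → p ≤ q) × (p ≤ q → T A q))

  IsTrim : Pred W 0ℓ → Set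
  IsTrim A = ∃ λ p → IsTrimAt p A

  P̂ : P → Set₁
  P̂ p = ∃ λ A → IsTrimAt p A

  IsSup : (P → Set₁) → P → Set₁
  IsSup S p = (∀ q → S q → q ≤ p) × (∀ u → (∀ q → S q → q ≤ u) → p ≤ u)

  IsSemiTrim : Set₁
  IsSemiTrim =
      (∀ (x : W) (U : Pred W 0ℓ) → Open τ U → U x →
          ∃ λ A → IsTrim A × A x × A ⊆ U)
    × (∀ (A : Pred W 0ℓ) p → Open τ A → T A p → P̂ p →
          ∃ λ B → IsTrimAt p B × B ⊆ A)
    × (∀ p (x : W) → X p x → IsSup (λ q → ∃ λ A → IsTrimAt q A × A x) p)
    × (∀ p (x : W) →
          (∀ (U : Pred W 0ℓ) → Open τ U → U x → ∃ λ A → IsTrimAt p A × A x × A ⊆ U) →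
          X p x)

  IsMaximal : P → Set
  IsMaximal p = ∀ q → p ≤ q → q ≡ p

IsIsolated : {W : Set} → Topology W → W → Set
IsIsolated τ x = Open τ (λ y → y ≡ x)

IsIsolatedIn : {W : Set} → Topology W → Pred W 0ℓ → W → Set₁
IsIsolatedIn {W} τ Y x = Y x × Σ (Pred W 0ℓ) λ U → Open τ U × U x × (∀ y → U y → Y y → y ≡ x)

-- If {x} is open it contains a q-trim set A, so T(A) = ↑q is
-- the single piece containing x, which makes q maximal.  Conversely, let U ∩ X_p = {x} with p maximal
-- and let A ⊆ U be a q-trim neighbourhood of x.  Any trim set B ⊆ A avoiding x (obtained from T₁) misses
-- X_p, so t(B) ≰ p.  Applied to a point of A ∩ X_q this gives q = p, and applied to any other point of A
-- it contradicts the maximality of p; hence A = {x}.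
module Submission where

open import Defs
open import Level using (0ℓ)
open import Data.Product using (Σ; ∃; _×_; _,_; proj₁; proj₂)
open import Data.Empty using (⊥-elim)
open import Relation.Unary using (Pred; _⊆_)
open import Relation.Binary using (Rel)
open import Relation.Binary.Structures using (IsPreorder; IsPartialOrder)
open import Relation.Binary.PropositionalEquality using (_≡_; _≢_; refl; subst)
open import Relation.Nullary using (¬_; yes; no)
open import Axiom.ExcludedMiddle using (ExcludedMiddle)
open import Function.Bundles using (_⇔_; mk⇔)

module _ {W P : Set} (τ : Topology W) (_≤_ : Rel P 0ℓ) (X : P → Pred W 0ℓ) where

  TrimNeighbourhoodBase : Set₁
  TrimNeighbourhoodBase =
    ∀ (x : W) (U : Pred W 0ℓ) → Open τ U → U x → ∃ λ A → IsTrim τ _≤_ X A × A x × A ⊆ U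

  T-mono : ∀ {A B : Pred W 0ℓ} → A ⊆ B → T τ _≤_ X A ⊆ T τ _≤_ X B
  T-mono A⊆B (y , Ay , Xy) = y , A⊆B Ay , Xy

  piece-unique : ExcludedMiddle 0ℓ → IsPPartition τ _≤_ X →
                 ∀ {p q z} → X p z → X q z → p ≡ q
  piece-unique em (disjoint , _) {p} {q} Xpz Xqz with em {p ≡ q}
  ... | yes p≡q = p≡q
  ... | no p≢q = ⊥-elim (disjoint p q _ p≢q Xpz Xqz)

  trim-avoiding : IsT₁ τ → TrimNeighbourhoodBase →
                  ∀ {A : Pred W 0ℓ} {x y} → Open τ A → A y → y ≢ x →
                  ∃ λ B → IsTrim τ _≤_ X B × B y × B ⊆ A × ¬ B x
  trim-avoiding t₁ base {A} {x} {y} openA Ay y≢x with t₁ y x y≢x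
  ... | V , openV , Vy , ¬Vx with base y (λ z → A z × V z) (Open-∩ τ openA openV) (Ay , Vy)
  ... | B , trimB , By , B⊆A∩V =
    B , trimB , By , (λ Bz → proj₁ (B⊆A∩V Bz)) , (λ Bx → ¬Vx (proj₂ (B⊆A∩V Bx)))

  trim-avoiding-isolated-point : ∀ {p x r} {U B : Pred W 0ℓ} →
                                 (∀ y → U y → X p y → y ≡ x) →
                                 IsTrimAt τ _≤_ X r B → B ⊆ U → ¬ B x → ¬ r ≤ p
  trim-avoiding-isolated-point {p} onlyx (_ , trimB) B⊆U ¬Bx r≤p
    with proj₂ (trimB p) r≤p
  ... | z , Bz , Xpz with onlyx z (B⊆U Bz) Xpz
  ... | refl = ¬Bx Bz

  module _ (preorder : IsPreorder _≡_ _≤_) where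
    open IsPreorder preorder using () renaming (refl to ≤-refl; trans to ≤-trans)

    trim-meets-own-piece : ∀ {p A} → IsTrimAt τ _≤_ X p A → T τ _≤_ X A p
    trim-meets-own-piece (_ , trimA) = proj₂ (trimA _) ≤-refl

    isolated⇒maximal-isolated-in-piece :
      ExcludedMiddle 0ℓ → IsPPartition τ _≤_ X → TrimNeighbourhoodBase → ∀ {x} →
      IsIsolated τ x → Σ P (λ p → IsMaximal τ _≤_ X p × IsIsolatedIn τ (X p) x)
    isolated⇒maximal-isolated-in-piece em partition base {x} isolated
      with base x (λ y → y ≡ x) isolated refl
    ... | A , (q , trimA) , _ , A⊆x with trim-meets-own-piece trimA
    ... | y , Ay , Xqy with A⊆x Ay
    ... | refl = q , maximal , Xqy , (λ z → z ≡ y) , isolated , refl , (λ _ z≡y _ → z≡y)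
      where
      maximal : IsMaximal τ _≤_ X q
      maximal r q≤r with proj₂ (proj₂ trimA r) q≤r
      ... | z , Az , Xrz with A⊆x Az
      ... | refl = piece-unique em partition Xrz Xqy

    maximal-isolated-in-piece⇒isolated :
      ExcludedMiddle 0ℓ → IsPPartition τ _≤_ X → IsT₁ τ → TrimNeighbourhoodBase → ∀ {x p} →
      IsMaximal τ _≤_ X p → IsIsolatedIn τ (X p) x → IsIsolated τ x
    maximal-isolated-in-piece⇒isolated em partition t₁ base {x} {p} maximal
                                       (Xpx , U , openU , Ux , onlyx)
      with base x U openU Ux
    ... | A , (q , openA , trimA) , Ax , A⊆U = Open-resp τ A⊆x (λ { refl → Ax }) openA
      where
      off-x-below-p : ∀ {y} → A y → y ≢ x →
                      ∃ λ r → ∃ λ B → IsTrimAt τ _≤_ X r B × B y × B ⊆ A × ¬ r ≤ p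
      off-x-below-p Ay y≢x with trim-avoiding t₁ base openA Ay y≢x
      ... | B , (r , trimB) , By , B⊆A , ¬Bx =
        r , B , trimB , By , B⊆A , trim-avoiding-isolated-point onlyx trimB (λ Bz → A⊆U (B⊆A Bz)) ¬Bx

      q≤p : q ≤ p
      q≤p = proj₁ (trimA p) (x , Ax , Xpx)

      q≡p : q ≡ p
      q≡p with trim-meets-own-piece (openA , trimA)
      ... | y , Ay , Xqy with em {y ≡ x}
      ... | yes refl = piece-unique em partition Xqy Xpx
      ... | no y≢x with off-x-below-p Ay y≢x
      ... | r , B , (_ , trimB) , By , _ , r≰p =
        ⊥-elim (r≰p (≤-trans (proj₁ (trimB q) (y , By , Xqy)) q≤p))

      A⊆x : ∀ {y} → A y → y ≡ x
      A⊆x {y} Ay with em {y ≡ x}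
      ... | yes y≡x = y≡x
      ... | no y≢x with off-x-below-p Ay y≢x
      ... | r , B , trimB , _ , B⊆A , r≰p
        with maximal r (subst (_≤ r) q≡p (proj₁ (trimA r) (T-mono B⊆A (trim-meets-own-piece trimB))))
      ... | refl = ⊥-elim (r≰p ≤-refl)

proposition2p7 : ExcludedMiddle 0ℓ →
    (P : Set) (_≤_ : Rel P 0ℓ) → IsPartialOrder _≡_ _≤_ →
    (W : Set) (τ : Topology W) → IsT₁ τ →
    (X : P → Pred W 0ℓ) → IsPPartition τ _≤_ X → IsSemiTrim τ _≤_ X →
    (x : W) →
    IsIsolated τ x ⇔ Σ P (λ p → IsMaximal τ _≤_ X p × IsIsolatedIn τ (X p) x)
proposition2p7 em P _≤_ partialOrder W τ t₁ X partition (base , _) x =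
  mk⇔ (isolated⇒maximal-isolated-in-piece τ _≤_ X preorder em partition base)
      (λ (p , maximal , isolatedIn) →
        maximal-isolated-in-piece⇒isolated τ _≤_ X preorder em partition t₁ base maximal isolatedIn)
  where
  preorder : IsPreorder _≡_ _≤_
  preorder = IsPartialOrder.isPreorder partialOrder
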